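{- Let $G'$ be a permutation graph and let $G$ be a spanning subgraph of $G'$ with $|E(G')\setminus E(G)|=1$. Then $G$ is $2$-word-$\pi$-representable by two $2$-uniform words, i.e. there exist $2$-uniform words $w,v$ with $\mathrm{alph}(w)=\mathrm{alph}(v)=V(G)$ and $G=G(w,v)$.
   Context: For a word $w$, $\mathrm{alph}(w)$ is the set of letters occurring in $w$ and $|w|_a$ the number of occurrences of $a$; $w$ is $k$-uniform if $|w|_a=k$ for all $a\in\mathrm{alph}(w)$. For letters $a,b$, $\pi_{a,b}$ is the monoid morphism on words with $a\mapsto a$, $b\mapsto b$ and all other letters mapped to the empty word. For words $w,v$ with $\mathrm{alph}(w)=\mathrm{alph}(v)=A$, $G(w,v)$ is the undirected simple graph on vertex set $A$ in which distinct $a,b$ are adjacent iff $\pi_{a,b}(w)=\pi_{a,b}(v)$. For a permutation $\sigma$ of $[n]$, $G(\sigma)$ is the graph on $[n]$ with $\{i,j\}$ an edge iff $(i-j)(\sigma^{ -1}(i)-\sigma^{ -1}(j))<0$; a permutation graph is a graph isomorphic to some $G(\sigma)$. A spanning subgraph of $G'$ is a subgraph with the same vertex set. -}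

module Defs where

open import Level using (0ℓ)
open import Data.Nat using (ℕ)
open import Data.Fin using (Fin; _<_; _≟_)
open import Data.Fin.Permutation using (Permutation′; _⟨$⟩ʳ_; _⟨$⟩ˡ_)
open import Data.List using (List; filter; length)
open import Data.List.Membership.Propositional using (_∈_)
open import Data.Product using (_×_; Σ; ∃; ∃-syntax; _,_)
open import Data.Sum using (_⊎_)
open import Relation.Nullary using (¬_)
open import Relation.Nullary.Decidable using (_⊎-dec_)
open import Relation.Binary.PropositionalEquality using (_≡_; _≢_)
open import Function.Bundles using (_⇔_)

record Graph (n : ℕ) : Set₁ where
  field
    Adj   : Fin n → Fin n → Set
    sym   : ∀ {i j} → Adj i j → Adj j i
    irrefl : ∀ {i} → ¬ Adj i i
open Graph public

PermAdj : ∀ {n} → Permutation′ n → Fin n → Fin n → Set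
PermAdj σ i j =
  (i < j × (σ ⟨$⟩ˡ j) < (σ ⟨$⟩ˡ i)) ⊎ (j < i × (σ ⟨$⟩ˡ i) < (σ ⟨$⟩ˡ j))

Isomorphic : ∀ {n} → (Fin n → Fin n → Set) → (Fin n → Fin n → Set) → Set
Isomorphic {n} E F =
  Σ (Permutation′ n) λ f → ∀ i j → E i j ⇔ F (f ⟨$⟩ʳ i) (f ⟨$⟩ʳ j)

IsPermutationGraph : ∀ {n} → Graph n → Set
IsPermutationGraph {n} G = Σ (Permutation′ n) λ σ → Isomorphic (Adj G) (PermAdj σ)

SameEdge : ∀ {n} → Fin n → Fin n → Fin n → Fin n → Set
SameEdge a b x y = (x ≡ a × y ≡ b) ⊎ (x ≡ b × y ≡ a)

SpanningMinusOneEdge : ∀ {n} → Graph n → Graph n → Set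
SpanningMinusOneEdge {n} G G' =
  (∀ x y → Adj G x y → Adj G' x y) ×
  ∃[ a ] ∃[ b ] (Adj G' a b × ¬ Adj G a b ×
    (∀ x y → Adj G' x y → ¬ SameEdge a b x y → Adj G x y))

Word : ℕ → Set
Word n = List (Fin n)

count : ∀ {n} → Fin n → Word n → ℕ
count a w = length (filter (_≟ a) w)

Uniform : ∀ {n} → ℕ → Word n → Set
Uniform k w = ∀ a → a ∈ w → count a w ≡ k

-- alph(w) = Fin n (every vertex occurs; the converse inclusion is automatic)
AlphIsAll : ∀ {n} → Word n → Set
AlphIsAll w = ∀ a → a ∈ w

proj : ∀ {n} → Fin n → Fin n → Word n → Word n
proj a b w = filter (λ x → (x ≟ a) ⊎-dec (x ≟ b)) w

Represents : ∀ {n} → Graph n → Word n → Word n → Set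
Represents G w v = ∀ a b → a ≢ b → (Adj G a b ⇔ (proj a b w ≡ proj a b v))

{-# OPTIONS --safe #-}
-- Let G' ≅ G(σ) via f. Listing the vertices in the order given by f, and then in
-- the reversed order given by σ⁻¹ ∘ f, yields words w₁ and v₁ in which every letter
-- occurs once and π_{x,y}(w₁) = π_{x,y}(v₁) exactly when x and y are inverted, i.e.
-- adjacent in G'. The words a b r and b a r, where r lists the remaining vertices,
-- agree on every pair except {a, b}. As π_{x,y}(w₁) and π_{x,y}(v₁) have the same
-- length, the concatenations w = w₁ a b r and v = v₁ b a r agree on {x, y} iff both
-- factors do, so G(w, v) is G' minus the edge ab, which is G.
module Submission where

open import Defs hiding (sym)
open import Data.Nat using (ℕ; suc; s≤s; _+_)
import Data.Nat.Properties as ℕ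
open import Data.Product using (_×_; ∃-syntax; _,_)
import Data.Product as Product
open import Data.Sum using (_⊎_; inj₁; inj₂)
import Data.Sum as Sum
open import Data.Empty using (⊥-elim)
open import Data.Fin using (Fin; zero; suc; _<_; _≟_)
open import Data.Fin.Properties using (<-cmp; <-asym; suc-injective; 0≢1+n)
open import Data.Fin.Permutation
  using (Permutation′; _⟨$⟩ʳ_; _⟨$⟩ˡ_; inverseˡ; inverseʳ; flip; _∘ₚ_)
import Data.Fin.Permutation as Perm
open import Data.List using (List; []; _∷_; [_]; _++_; filter; length; tabulate; reverse; allFin)
open import Data.List.Properties
  using (filter-accept; filter-reject; filter-none; filter-++; filter-≐;
         unfold-reverse; length-reverse; length-++; ++-identityʳ; ∷-injective; ∷-injectiveˡ)
open import Data.List.Membership.Propositional using (_∈_)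
open import Data.List.Membership.Propositional.Properties using (∈-tabulate⁺; ∈-++⁺ˡ)
open import Data.List.Relation.Unary.Any.Properties using (reverse⁺)
import Data.List.Relation.Unary.All as All
open import Data.List.Relation.Unary.All.Properties using (tabulate⁺; all-filter)
open import Relation.Nullary using (¬_; yes; no)
open import Relation.Nullary.Decidable using (_⊎-dec_)
open import Relation.Unary using (Pred; Decidable)
open import Relation.Unary.Properties using (∁?)
open import Relation.Binary using (tri<; tri≈; tri>)
open import Relation.Binary.PropositionalEquality
  using (_≡_; _≢_; refl; sym; trans; cong; cong₂; subst; module ≡-Reasoning)
open import Function.Base using (_∘_)
open import Function.Bundles using (_⇔_; mk⇔)
open import Function.Construct.Identity using (⇔-id)
open import Function.Related.Propositional using (module EquationalReasoning)
open import Data.Product.Function.NonDependent.Propositional using (_×-⇔_)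

private
  variable
    n : ℕ

module _ {a p} {A : Set a} {P : Pred A p} (P? : Decidable P) where

  filter-tabulate-single : ∀ {m} (h : Fin m → A) {i} → P (h i) → (∀ k → P (h k) → k ≡ i) →
                           filter P? (tabulate h) ≡ [ h i ]
  filter-tabulate-single h {zero} Phi unique =
    trans (filter-accept P? Phi)
          (cong (h zero ∷_) (filter-none P? (tabulate⁺ λ k Phk → 0≢1+n (sym (unique (suc k) Phk)))))
  filter-tabulate-single h {suc i} Phi unique =
    trans (filter-reject P? (λ Ph0 → 0≢1+n (unique zero Ph0)))
          (filter-tabulate-single (λ k → h (suc k)) Phi
            (λ k Phk → suc-injective (unique (suc k) Phk)))

  filter-tabulate-pair : ∀ {m} (h : Fin m → A) {i j} → i < j → P (h i) → P (h j) →
                         (∀ k → P (h k) → k ≡ i ⊎ k ≡ j) →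
                         filter P? (tabulate h) ≡ h i ∷ h j ∷ []
  filter-tabulate-pair h {zero} {suc j} _ Phi Phj unique =
    trans (filter-accept P? Phi)
          (cong (h zero ∷_) (filter-tabulate-single (λ k → h (suc k)) Phj
            (λ k Phk → Sum.[ (λ k≡0 → ⊥-elim (0≢1+n (sym k≡0))) , suc-injective ]
                             (unique (suc k) Phk))))
  filter-tabulate-pair h {suc i} {suc j} (s≤s i<j) Phi Phj unique =
    trans (filter-reject P? (λ Ph0 → Sum.[ 0≢1+n , 0≢1+n ] (unique zero Ph0)))
          (filter-tabulate-pair (λ k → h (suc k)) i<j Phi Phj
            (λ k Phk → Sum.map suc-injective suc-injective (unique (suc k) Phk)))

  filter-reverse : ∀ xs → filter P? (reverse xs) ≡ reverse (filter P? xs)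
  filter-reverse [] = refl
  filter-reverse (x ∷ xs) = begin
    filter P? (reverse (x ∷ xs))              ≡⟨ cong (filter P?) (unfold-reverse x xs) ⟩
    filter P? (reverse xs ++ [ x ])           ≡⟨ filter-++ P? (reverse xs) [ x ] ⟩
    filter P? (reverse xs) ++ filter P? [ x ] ≡⟨ cong (_++ filter P? [ x ]) (filter-reverse xs) ⟩
    reverse (filter P? xs) ++ filter P? [ x ] ≡⟨ snoc-filter ⟩
    reverse (filter P? (x ∷ xs))              ∎
    where
    open ≡-Reasoning
    snoc-filter : reverse (filter P? xs) ++ filter P? [ x ] ≡ reverse (filter P? (x ∷ xs))
    snoc-filter with P? x
    ... | yes _ = sym (unfold-reverse x (filter P? xs))
    ... | no  _ = ++-identityʳ _

  filter-swap : ∀ x y zs → ¬ (P x × P y) → filter P? (x ∷ y ∷ zs) ≡ filter P? (y ∷ x ∷ zs)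
  filter-swap x y zs ¬both with P? x | P? y
  ... | yes Px | yes Py = ⊥-elim (¬both (Px , Py))
  ... | yes Px | no ¬Py = trans (cong (x ∷_) (filter-reject P? ¬Py)) (sym (filter-accept P? Px))
  ... | no ¬Px | yes Py = trans (filter-accept P? Py) (cong (y ∷_) (sym (filter-reject P? ¬Px)))
  ... | no ¬Px | no ¬Py = trans (filter-reject P? ¬Py) (sym (filter-reject P? ¬Px))

++-injective : ∀ {a} {A : Set a} {xs ys zs ws : List A} →
               length xs ≡ length ys → xs ++ zs ≡ ys ++ ws → xs ≡ ys × zs ≡ ws
++-injective {xs = []}     {[]}     _   eq = refl , eq
++-injective {xs = x ∷ xs} {y ∷ ys} len eq with ∷-injective eq
... | refl , eq′ =
  Product.map₁ (cong (x ∷_)) (++-injective {xs = xs} {ys} (ℕ.suc-injective len) eq′)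

onPair? : (x y : Fin n) → Decidable (λ z → z ≡ x ⊎ z ≡ y)
onPair? x y z = (z ≟ x) ⊎-dec (z ≟ y)

module _ {x y : Fin n} where

  proj-comm : ∀ w → proj x y w ≡ proj y x w
  proj-comm = filter-≐ _ _ (Sum.swap , Sum.swap)

  proj-++ : ∀ u w → proj x y (u ++ w) ≡ proj x y u ++ proj x y w
  proj-++ = filter-++ _

  proj-reverse : ∀ w → proj x y (reverse w) ≡ reverse (proj x y w)
  proj-reverse = filter-reverse _

module _ (c : Fin n) where

  count-++ : ∀ u w → count c (u ++ w) ≡ count c u + count c w
  count-++ u w = trans (cong length (filter-++ _ u w)) (length-++ (filter (_≟ c) u))

  count-reverse : ∀ w → count c (reverse w) ≡ count c w
  count-reverse w = trans (cong length (filter-reverse _ w)) (length-reverse (filter (_≟ c) w))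

  count-here : ∀ w → count c (c ∷ w) ≡ suc (count c w)
  count-here w = cong length (filter-accept (_≟ c) refl)

  count-there : ∀ {x} w → x ≢ c → count c (x ∷ w) ≡ count c w
  count-there w x≢c = cong length (filter-reject (_≟ c) x≢c)

  count-swap : ∀ x y w → count c (x ∷ y ∷ w) ≡ count c (y ∷ x ∷ w)
  count-swap x y w with x ≟ y
  ... | yes refl = refl
  ... | no x≢y   = cong length (filter-swap (_≟ c) x y w λ (x≡c , y≡c) → x≢y (trans x≡c (sym y≡c)))

  module _ {p} {P : Pred (Fin n) p} (P? : Decidable P) where

    count-filter-accept : P c → ∀ w → count c (filter P? w) ≡ count c w
    count-filter-accept Pc [] = refl
    count-filter-accept Pc (x ∷ w) with P? x | x ≟ c
    ... | yes _  | yes refl = trans (count-here (filter P? w)) (cong suc (count-filter-accept Pc w))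
    ... | yes _  | no x≢c   = trans (count-there (filter P? w) x≢c) (count-filter-accept Pc w)
    ... | no ¬Px | yes refl = ⊥-elim (¬Px Pc)
    ... | no _   | no _     = count-filter-accept Pc w

    count-filter-reject : ¬ P c → ∀ w → count c (filter P? w) ≡ 0
    count-filter-reject ¬Pc w =
      cong length (filter-none (_≟ c) (All.map (λ { Pz refl → ¬Pc Pz }) (all-filter P? w)))

-- The one-line notation π(0) π(1) … π(n-1); the letter x sits at position π ⟨$⟩ˡ x.
oneLine : Permutation′ n → Word n
oneLine π = tabulate (π ⟨$⟩ʳ_)

module _ (π : Permutation′ n) where

  position-unique : ∀ {k x} → π ⟨$⟩ʳ k ≡ x → k ≡ π ⟨$⟩ˡ x
  position-unique refl = sym (inverseˡ π)

  position-injective : ∀ {x y} → π ⟨$⟩ˡ x ≡ π ⟨$⟩ˡ y → x ≡ y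
  position-injective {x} {y} eq = trans (sym (inverseʳ π)) (trans (cong (π ⟨$⟩ʳ_) eq) (inverseʳ π))

  ∈-oneLine : ∀ x → x ∈ oneLine π
  ∈-oneLine x = subst (_∈ oneLine π) (inverseʳ π) (∈-tabulate⁺ (π ⟨$⟩ˡ x))

  count-oneLine : ∀ x → count x (oneLine π) ≡ 1
  count-oneLine x =
    cong length (filter-tabulate-single (_≟ x) (π ⟨$⟩ʳ_) (inverseʳ π) (λ _ → position-unique))

  proj-oneLine-< : ∀ {x y} → π ⟨$⟩ˡ x < π ⟨$⟩ˡ y → proj x y (oneLine π) ≡ x ∷ y ∷ []
  proj-oneLine-< x<y =
    trans (filter-tabulate-pair _ (π ⟨$⟩ʳ_) x<y (inj₁ (inverseʳ π)) (inj₂ (inverseʳ π))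
                                (λ _ → Sum.map position-unique position-unique))
          (cong₂ (λ x′ y′ → x′ ∷ y′ ∷ []) (inverseʳ π) (inverseʳ π))

  proj-oneLine-> : ∀ {x y} → π ⟨$⟩ˡ y < π ⟨$⟩ˡ x → proj x y (oneLine π) ≡ y ∷ x ∷ []
  proj-oneLine-> y<x = trans (proj-comm (oneLine π)) (proj-oneLine-< y<x)

  count-reverse-oneLine : ∀ x → count x (reverse (oneLine π)) ≡ 1
  count-reverse-oneLine x = trans (count-reverse x (oneLine π)) (count-oneLine x)

  length-proj-oneLine : ∀ {x y} → x ≢ y → length (proj x y (oneLine π)) ≡ 2
  length-proj-oneLine {x} {y} x≢y with <-cmp (π ⟨$⟩ˡ x) (π ⟨$⟩ˡ y)
  ... | tri< x<y _ _ = cong length (proj-oneLine-< x<y)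
  ... | tri≈ _ x≡y _ = ⊥-elim (x≢y (position-injective x≡y))
  ... | tri> _ _ y<x = cong length (proj-oneLine-> y<x)

  length-proj-reverse-oneLine : ∀ {x y} → x ≢ y → length (proj x y (reverse (oneLine π))) ≡ 2
  length-proj-reverse-oneLine {x} {y} x≢y = begin
    length (proj x y (reverse (oneLine π))) ≡⟨ cong length (proj-reverse (oneLine π)) ⟩
    length (reverse (proj x y (oneLine π))) ≡⟨ length-reverse (proj x y (oneLine π)) ⟩
    length (proj x y (oneLine π))           ≡⟨ length-proj-oneLine x≢y ⟩
    2                                       ∎
    where open ≡-Reasoning

WordAdj : Word n → Word n → Fin n → Fin n → Set
WordAdj w v x y = proj x y w ≡ proj x y v

Discordant : (Fin n → Fin n) → (Fin n → Fin n) → Fin n → Fin n → Set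
Discordant r s x y = (r x < r y × s y < s x) ⊎ (r y < r x × s x < s y)

wordAdj-++ : ∀ {x y : Fin n} w₁ {w₂} v₁ {v₂} → length (proj x y w₁) ≡ length (proj x y v₁) →
             (WordAdj w₁ v₁ x y × WordAdj w₂ v₂ x y) ⇔ WordAdj (w₁ ++ w₂) (v₁ ++ v₂) x y
wordAdj-++ w₁ {w₂} v₁ {v₂} len = mk⇔
  (λ (eq₁ , eq₂) → trans (proj-++ w₁ w₂) (trans (cong₂ _++_ eq₁ eq₂) (sym (proj-++ v₁ v₂))))
  (λ eq → ++-injective len (trans (sym (proj-++ w₁ w₂)) (trans eq (proj-++ v₁ v₂))))

wordAdj-oneLine-reverse : ∀ (π ρ : Permutation′ n) {x y} → x ≢ y →
  Discordant (π ⟨$⟩ˡ_) (ρ ⟨$⟩ˡ_) x y ⇔ WordAdj (oneLine π) (reverse (oneLine ρ)) x y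
wordAdj-oneLine-reverse π ρ {x} {y} x≢y rewrite proj-reverse {x = x} {y} (oneLine ρ)
  with <-cmp (π ⟨$⟩ˡ x) (π ⟨$⟩ˡ y) | <-cmp (ρ ⟨$⟩ˡ x) (ρ ⟨$⟩ˡ y)
... | tri≈ _ eq _ | _ = ⊥-elim (x≢y (position-injective π eq))
... | _ | tri≈ _ eq _ = ⊥-elim (x≢y (position-injective ρ eq))
... | tri< πxy _ _ | tri> _ _ ρyx rewrite proj-oneLine-< π πxy | proj-oneLine-> ρ ρyx =
  mk⇔ (λ _ → refl) (λ _ → inj₁ (πxy , ρyx))
... | tri> _ _ πyx | tri< ρxy _ _ rewrite proj-oneLine-> π πyx | proj-oneLine-< ρ ρxy =
  mk⇔ (λ _ → refl) (λ _ → inj₂ (πyx , ρxy))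
... | tri< πxy _ _ | tri< ρxy _ _ rewrite proj-oneLine-< π πxy | proj-oneLine-< ρ ρxy =
  mk⇔ (λ { (inj₁ (_ , ρyx)) → ⊥-elim (<-asym ρxy ρyx)
         ; (inj₂ (πyx , _)) → ⊥-elim (<-asym πxy πyx) })
      (λ eq → ⊥-elim (x≢y (∷-injectiveˡ eq)))
... | tri> _ _ πyx | tri> _ _ ρyx rewrite proj-oneLine-> π πyx | proj-oneLine-> ρ ρyx =
  mk⇔ (λ { (inj₁ (πxy , _)) → ⊥-elim (<-asym πxy πyx)
         ; (inj₂ (_ , ρxy)) → ⊥-elim (<-asym ρxy ρyx) })
      (λ eq → ⊥-elim (x≢y (sym (∷-injectiveˡ eq))))

module _ {a b x y : Fin n} where

  sameEdge⇒both : SameEdge a b x y → (a ≡ x ⊎ a ≡ y) × (b ≡ x ⊎ b ≡ y)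
  sameEdge⇒both (inj₁ (refl , refl)) = inj₁ refl , inj₂ refl
  sameEdge⇒both (inj₂ (refl , refl)) = inj₂ refl , inj₁ refl

  both⇒sameEdge : a ≢ b → (a ≡ x ⊎ a ≡ y) × (b ≡ x ⊎ b ≡ y) → SameEdge a b x y
  both⇒sameEdge a≢b (inj₁ refl , inj₁ refl) = ⊥-elim (a≢b refl)
  both⇒sameEdge a≢b (inj₁ refl , inj₂ refl) = inj₁ (refl , refl)
  both⇒sameEdge a≢b (inj₂ refl , inj₁ refl) = inj₂ (refl , refl)
  both⇒sameEdge a≢b (inj₂ refl , inj₂ refl) = ⊥-elim (a≢b refl)

  wordAdj-swap-front : ∀ zs → a ≢ b → (¬ SameEdge a b x y) ⇔ WordAdj (a ∷ b ∷ zs) (b ∷ a ∷ zs) x y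
  wordAdj-swap-front zs a≢b = mk⇔
    (λ ¬ab → filter-swap (onPair? x y) a b zs (¬ab ∘ both⇒sameEdge a≢b))
    (λ eq ab → let Pa , Pb = sameEdge⇒both ab in
      a≢b (∷-injectiveˡ (trans (sym (proj-accept Pa)) (trans eq (proj-accept Pb)))))
    where
    proj-accept : ∀ {z zs} → z ≡ x ⊎ z ≡ y → proj x y (z ∷ zs) ≡ z ∷ proj x y zs
    proj-accept = filter-accept (onPair? x y)

others : Fin n → Fin n → Word n
others a b = filter (∁? (onPair? a b)) (allFin _)

module _ {a b : Fin n} where

  count-others-∈ : ∀ {c} → c ≡ a ⊎ c ≡ b → count c (others a b) ≡ 0
  count-others-∈ {c} c∈ab = count-filter-reject c (∁? (onPair? a b)) (λ c∉ab → c∉ab c∈ab) (allFin _)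

  count-others-∉ : ∀ {c} → ¬ (c ≡ a ⊎ c ≡ b) → count c (others a b) ≡ 1
  count-others-∉ {c} c∉ab =
    trans (count-filter-accept c (∁? (onPair? a b)) c∉ab (allFin _)) (count-oneLine Perm.id c)

  count-front : a ≢ b → ∀ c → count c (a ∷ b ∷ others a b) ≡ 1
  count-front a≢b c with c ≟ a | c ≟ b
  ... | yes refl | _ =
    trans (count-here a _)
          (cong suc (trans (count-there a _ (a≢b ∘ sym)) (count-others-∈ (inj₁ refl))))
  ... | no _ | yes refl =
    trans (count-there b _ a≢b) (trans (count-here b _) (cong suc (count-others-∈ (inj₂ refl))))
  ... | no c≢a | no c≢b =
    trans (count-there c _ (c≢a ∘ sym))
          (trans (count-there c _ (c≢b ∘ sym)) (count-others-∉ Sum.[ c≢a , c≢b ]))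

  count-front-swapped : a ≢ b → ∀ c → count c (b ∷ a ∷ others a b) ≡ 1
  count-front-swapped a≢b c = trans (count-swap c b a (others a b)) (count-front a≢b c)

wordAdj-discordant-minus-edge : ∀ (π ρ : Permutation′ n) {a b x y} → a ≢ b → x ≢ y →
  (Discordant (π ⟨$⟩ˡ_) (ρ ⟨$⟩ˡ_) x y × ¬ SameEdge a b x y) ⇔
  WordAdj (oneLine π ++ a ∷ b ∷ others a b) (reverse (oneLine ρ) ++ b ∷ a ∷ others a b) x y
wordAdj-discordant-minus-edge π ρ {a} {b} {x} {y} a≢b x≢y = begin
  (Discordant (π ⟨$⟩ˡ_) (ρ ⟨$⟩ˡ_) x y × ¬ SameEdge a b x y)
    ∼⟨ wordAdj-oneLine-reverse π ρ x≢y ×-⇔ wordAdj-swap-front (others a b) a≢b ⟩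
  (WordAdj (oneLine π) (reverse (oneLine ρ)) x y ×
   WordAdj (a ∷ b ∷ others a b) (b ∷ a ∷ others a b) x y)
    ∼⟨ wordAdj-++ (oneLine π) (reverse (oneLine ρ)) same-length ⟩
  WordAdj (oneLine π ++ a ∷ b ∷ others a b) (reverse (oneLine ρ) ++ b ∷ a ∷ others a b) x y
    ∎
  where
  open EquationalReasoning
  same-length : length (proj x y (oneLine π)) ≡ length (proj x y (reverse (oneLine ρ)))
  same-length = trans (length-proj-oneLine π x≢y) (sym (length-proj-reverse-oneLine ρ x≢y))

uniform-++ : ∀ (u w : Word n) → (∀ c → count c u ≡ 1) → (∀ c → count c w ≡ 1) → Uniform 2 (u ++ w)
uniform-++ u w once-u once-w c _ = trans (count-++ c u w) (cong₂ _+_ (once-u c) (once-w c))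

adj-minus-edge : ∀ (G G' : Graph n) {a b} →
  (∀ x y → Adj G x y → Adj G' x y) → ¬ Adj G a b →
  (∀ x y → Adj G' x y → ¬ SameEdge a b x y → Adj G x y) →
  ∀ x y → Adj G x y ⇔ (Adj G' x y × ¬ SameEdge a b x y)
adj-minus-edge G G' G⊆G' ¬Gab G'∖ab⊆G x y = mk⇔
  (λ Gxy → G⊆G' x y Gxy , λ { (inj₁ (refl , refl)) → ¬Gab Gxy
                            ; (inj₂ (refl , refl)) → ¬Gab (Graph.sym G Gxy) })
  (λ (G'xy , ¬ab) → G'∖ab⊆G x y G'xy ¬ab)

theorem3 : ∀ {n : ℕ} (G' G : Graph n) →
    IsPermutationGraph G' →
    SpanningMinusOneEdge G G' →
    ∃[ w ] ∃[ v ] (Uniform 2 w × Uniform 2 v × AlphIsAll w × AlphIsAll v × Represents G w v)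
theorem3 G' G (σ , f , G'≅σ) (G⊆G' , a , b , G'ab , ¬Gab , G'∖ab⊆G) =
  w , v , uniform-++ (oneLine π) _ (count-oneLine π) (count-front a≢b) ,
  uniform-++ (reverse (oneLine ρ)) _ (count-reverse-oneLine ρ) (count-front-swapped a≢b) ,
  ∈-++⁺ˡ ∘ ∈-oneLine π , ∈-++⁺ˡ ∘ reverse⁺ ∘ ∈-oneLine ρ , represents
  where
  -- Chosen so that PermAdj σ (f ⟨$⟩ʳ x) (f ⟨$⟩ʳ y) is definitionally
  -- Discordant (π ⟨$⟩ˡ_) (ρ ⟨$⟩ˡ_) x y.
  π ρ : Permutation′ _
  π = flip f
  ρ = σ ∘ₚ flip f
  a≢b : a ≢ b
  a≢b refl = irrefl G' G'ab
  w v : Word _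
  w = oneLine π ++ a ∷ b ∷ others a b
  v = reverse (oneLine ρ) ++ b ∷ a ∷ others a b
  represents : Represents G w v
  represents x y x≢y = begin
    Adj G x y
      ∼⟨ adj-minus-edge G G' G⊆G' ¬Gab G'∖ab⊆G x y ⟩
    (Adj G' x y × ¬ SameEdge a b x y)
      ∼⟨ G'≅σ x y ×-⇔ ⇔-id _ ⟩
    (PermAdj σ (f ⟨$⟩ʳ x) (f ⟨$⟩ʳ y) × ¬ SameEdge a b x y)
      ∼⟨ wordAdj-discordant-minus-edge π ρ a≢b x≢y ⟩
    WordAdj w v x y
      ∎
    where open EquationalReasoning
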